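{- Let $N\ge 1$ and $0\le k\le r$ be integers, and let $T \in \mathrm{Inc}_k(N-r,1^r)$. Then $\psi(\partial(T))=\partial(\psi(T))$, where on the left $\partial$ is $K$-promotion on $\mathrm{Inc}_k(N-r,1^r)$ and on the right $\partial$ is (jeu de taquin) promotion on $\mathrm{SYT}(N-r-k,1^r)$.
   Context: For a partition $\lambda$ of $N$, an increasing $\lambda$-tableau is a filling of the Young diagram of $\lambda$ with positive integers, strictly increasing along rows and down columns, such that if $N-k$ is the largest entry then every integer $1,\dots,N-k$ appears. $\mathrm{Inc}_k(\lambda)$ is the set of such tableaux with maximum entry $N-k$, and $\mathrm{SYT}(\lambda)=\mathrm{Inc}_0(\lambda)$. The hook shape $(N-r,1^r)$ has a first row of length $N-r$ and a first column of length $r+1$. In a hook increasing tableau the entry $1$ occurs only in box $(1,1)$, and exactly $k$ values of the first row (outside box $(1,1)$) also occur in the first column. $K$-promotion $\partial$ on $\mathrm{Inc}_k(N-r,1^r)$: replace the $1$ by a dot, then repeatedly move dots: a dot with right neighbour $a$ and lower neighbour $b$ becomes: if $a<b$, $a$ moves into the dot's box and the dot moves right; if $b<a$, $b$ moves into the dot's box and the dot moves down; if $a=b$, $a$ moves into the dot's box and dots occupy both the box to the right and the box below (a dot with only one neighbour exchanges with it). Continue until every dot lies in the last box of the first row or the last box of the first column. Then replace each dot by $N-k$ and decrease every other entry by $1$; the result is $\partial(T)$. For $k=0$ this is Schützenberger's jeu de taquin promotion on standard tableaux. The map $\psi:\mathrm{Inc}_k(N-r,1^r)\to\mathrm{SYT}(N-r-k,1^r)$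 deletes from the first row of $T$ the $k$ entries that also appear in the first column (and left-justifies the remaining row). -}

module Defs where

open import Data.Nat using (ℕ; zero; suc; _∸_; _≤_; _<_; _<ᵇ_; _≡ᵇ_; _≟_)
open import Data.Bool using (Bool; true; false; if_then_else_)
open import Data.Maybe using (Maybe; just; nothing)
open import Data.List using (List; []; _∷_; _++_; map; filter; length)
open import Data.List.Relation.Unary.All using (All)
open import Data.List.Relation.Unary.Linked using (Linked)
open import Data.List.Membership.Propositional using (_∈_)
open import Data.List.Membership.DecPropositional _≟_ using (_∈?_)
open import Data.Product using (_×_)
open import Relation.Nullary using (¬?)
open import Relation.Binary.PropositionalEquality using (_≡_)

-- A filling of a hook shape (a, 1^l):
--   corner = entry of box (1,1),
--   arm    = entries of the first row to the right of (1,1), left to right,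
--   leg    = entries of the first column below (1,1), top to bottom.
record Hook : Set where
  constructor hook
  field
    corner : ℕ
    arm    : List ℕ
    leg    : List ℕ
open Hook public

cells : Hook → List ℕ
cells h = corner h ∷ (arm h ++ leg h)

HookShape : ℕ → ℕ → Hook → Set
HookShape N r h = (suc (length (arm h) Data.Nat.+ length (leg h)) ≡ N) × (length (leg h) ≡ r)

IsIncreasing : ℕ → Hook → Set
IsIncreasing M h =
  Linked _<_ (corner h ∷ arm h) ×
  Linked _<_ (corner h ∷ leg h) ×
  All (λ x → (1 ≤ x) × (x ≤ M)) (cells h) ×
  (∀ i → 1 ≤ i → i ≤ M → i ∈ cells h)

InInc : ℕ → ℕ → ℕ → Hook → Set
InInc N r k T = HookShape N r T × IsIncreasing (N ∸ k) T

InSYT : ℕ → ℕ → Hook → Set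
InSYT N r T = InInc N r 0 T

-- K-promotion on hooks, following the dot-sliding rules literally.
-- A cell is either a number (just x) or a dot (nothing).

Cell : Set
Cell = Maybe ℕ

-- a dot sitting in front of the given line (which has no boxes below it,
-- so each box has only its right/lower neighbour in the line) exchanges with
-- its unique neighbour until it reaches the last box of the line.
slide : List ℕ → List Cell
slide []       = nothing ∷ []
slide (a ∷ xs) = just a ∷ slide xs

keep : List ℕ → List Cell
keep = map just

record HookC : Set where
  constructor hookC
  field
    cornerC : Cell
    armC    : List Cell
    legC    : List Cell

-- the 1 in box (1,1) is replaced by a dot, which then moves.
slideDots : Hook → HookC
slideDots (hook _ [] [])             = hookC nothing [] []
slideDots (hook _ (a ∷ as) [])       = hookC (just a) (slide as) []
slideDots (hook _ [] (b ∷ bs))       = hookC (just b) [] (slide bs)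
slideDots (hook _ (a ∷ as) (b ∷ bs)) =
  if a <ᵇ b then hookC (just a) (slide as) (keep (b ∷ bs))
  else if b <ᵇ a then hookC (just b) (keep (a ∷ as)) (slide bs)
  else hookC (just a) (slide as) (slide bs)   -- a = b: dot splits

finalCell : ℕ → Cell → ℕ
finalCell M nothing  = M
finalCell M (just x) = x ∸ 1

finalize : ℕ → HookC → Hook
finalize M (hookC c a l) = hook (finalCell M c) (map (finalCell M) a) (map (finalCell M) l)

kPromotion : ℕ → Hook → Hook
kPromotion M T = finalize M (slideDots T)

ψ : Hook → Hook
ψ (hook c a l) = hook c (filter (λ x → ¬? (x ∈? l)) a) l

size : Hook → ℕ
size h = suc (length (arm h) Data.Nat.+ length (leg h))

-- Schützenberger (jeu de taquin) promotion on a standard hook tableau: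
-- the K-promotion with k = 0, i.e. the dot is replaced by the number of boxes.
promotion : Hook → Hook
promotion T = kPromotion (size T) T

-- Lowering all entries by one does not
-- change which arm entries reappear, and the dot of K-promotion ends in the arm, in the leg, or
-- (at a tie) in both; a case split on which neighbour of the dot is smaller therefore shows
-- ψ ∘ ∂ = ∂ ∘ ψ with the same maximum entry M = N − k. Because T is increasing, the entries of ψ T
-- are distinct and are exactly 1, …, M, so ψ T has M boxes and ∂ on it is jeu de taquin promotion.
module Submission where

open import Defs
open import Data.Nat using (ℕ; suc; z≤n; _≤_; _<_; _∸_; _<ᵇ_; _≟_; s≤s)
open import Data.Nat.Properties using (<-trans; <-irrefl; <-asym; <-cmp; <⇒≢; <⇒<ᵇ; <ᵇ⇒<)
open import Data.Bool using (true; false)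
open import Data.List using (List; []; _∷_; _++_; [_]; _∷ʳ_; map; filter; length; applyUpTo)
open import Data.List.Properties
  using (filter-++; filter-accept; filter-reject; filter-all; ++-identityʳ; length-++; length-applyUpTo; map-∘)
open import Data.List.Relation.Unary.All as All using (All; []; _∷_)
open import Data.List.Relation.Unary.All.Properties using (++⁺; ++⁻ˡ; ++⁻ʳ; filter⁺)
open import Data.List.Relation.Unary.Any using (here; there)
open import Data.List.Relation.Unary.Linked as Linked using (Linked)
open import Data.List.Relation.Unary.Linked.Properties using (Linked⇒All; Linked⇒AllPairs)
open import Data.List.Relation.Unary.AllPairs as AllPairs using (_∷_)
open import Data.List.Relation.Unary.Unique.Propositional using (Unique)
import Data.List.Relation.Unary.Unique.Propositional.Properties as Unique
open import Data.List.Relation.Binary.Disjoint.Propositional using (Disjoint)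
open import Data.List.Relation.Binary.BagAndSetEquality using (∼bag⇒↭)
open import Data.List.Relation.Binary.Permutation.Propositional.Properties using (↭-length)
open import Data.List.Membership.Propositional using (_∈_; _∉_)
open import Data.List.Membership.Propositional.Properties
  using (∈-++⁺ˡ; ∈-++⁺ʳ; ∈-++⁻; ∈-map⁺; ∈-map⁻; ∈-filter⁺; ∈-filter⁻; ∈-applyUpTo⁺; ∈-applyUpTo⁻)
open import Data.List.Membership.Propositional.Properties.WithK using (unique∧set⇒bag)
open import Data.List.Membership.DecPropositional _≟_ using (_∈?_; _∉?_)
open import Data.Product using (_×_; _,_; proj₁; proj₂)
open import Data.Sum using (inj₁; inj₂)
open import Data.Empty using (⊥-elim)
open import Function.Base using (_∘_)
open import Relation.Unary using (Pred; Decidable)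
open import Function.Bundles using (_⇔_; mk⇔; Equivalence)
import Function.Properties.Equivalence as ⇔
open import Relation.Nullary using (¬_; yes; no; contradiction)
open import Relation.Binary.Definitions using (tri<; tri≈; tri>)
open import Relation.Binary.PropositionalEquality using (_≡_; refl; sym; trans; cong; cong₂; module ≡-Reasoning)

open ≡-Reasoning
open Equivalence using (to; from)

head<tail : ∀ {x xs} → Linked _<_ (x ∷ xs) → All (x <_) xs
head<tail x<xs with x<xs′ ∷ _ ← Linked⇒AllPairs <-trans x<xs = x<xs′

<-all⇒∉ : ∀ {x xs} → All (x <_) xs → x ∉ xs
<-all⇒∉ x<xs x∈xs = <-irrefl refl (All.lookup x<xs x∈xs)

Linked-<⇒Unique : ∀ {xs} → Linked _<_ xs → Unique xs
Linked-<⇒Unique xs↑ = AllPairs.map <⇒≢ (Linked⇒AllPairs <-trans xs↑)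

filter-∉-[] : ∀ xs → filter (_∉? []) xs ≡ xs
filter-∉-[] xs = filter-all (_∉? []) (All.universal (λ _ ()) xs)

filter-∉-cong : ∀ {ys zs} xs → (∀ {x} → x ∈ xs → x ∈ ys ⇔ x ∈ zs) →
                filter (_∉? ys) xs ≡ filter (_∉? zs) xs
filter-∉-cong [] _ = refl
filter-∉-cong {ys} {zs} (x ∷ xs) same with x ∈? ys
... | yes x∈ys = trans (filter-∉-cong xs (same ∘ there))
                       (sym (filter-reject (_∉? zs) (λ x∉zs → x∉zs (to (same (here refl)) x∈ys))))
... | no x∉ys = trans (cong (x ∷_) (filter-∉-cong xs (same ∘ there)))
                      (sym (filter-accept (_∉? zs) (λ x∈zs → x∉ys (from (same (here refl)) x∈zs))))

filter-∉-++ʳ : ∀ {ys zs} xs → Disjoint xs zs → filter (_∉? (ys ++ zs)) xs ≡ filter (_∉? ys) xs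
filter-∉-++ʳ {ys} xs xs#zs = filter-∉-cong xs λ x∈xs → mk⇔ (from-++ x∈xs) (∈-++⁺ˡ)
  where
  from-++ : ∀ {x} → x ∈ xs → x ∈ ys ++ _ → x ∈ ys
  from-++ x∈xs x∈ys++zs with ∈-++⁻ ys x∈ys++zs
  ... | inj₁ x∈ys = x∈ys
  ... | inj₂ x∈zs = contradiction (x∈xs , x∈zs) xs#zs

filter-∉-∷ : ∀ {y ys} xs → y ∉ xs → filter (_∉? (y ∷ ys)) xs ≡ filter (_∉? ys) xs
filter-∉-∷ {y} {ys} xs y∉xs = filter-∉-cong xs λ x∈xs → mk⇔ (from-∷ x∈xs) there
  where
  from-∷ : ∀ {x} → x ∈ xs → x ∈ y ∷ ys → x ∈ ys
  from-∷ x∈xs (here refl) = contradiction x∈xs y∉xs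
  from-∷ _    (there x∈ys) = x∈ys

filter-∉-map : ∀ (f : ℕ → ℕ) {ys} xs → (∀ {x} → x ∈ xs → f x ∈ map f ys → x ∈ ys) →
               filter (_∉? map f ys) (map f xs) ≡ map f (filter (_∉? ys) xs)
filter-∉-map f [] _ = refl
filter-∉-map f {ys} (x ∷ xs) reflects with x ∈? ys
... | yes x∈ys = trans (filter-reject (_∉? map f ys) (λ fx∉ → fx∉ (∈-map⁺ f x∈ys)))
                       (filter-∉-map f xs (reflects ∘ there))
... | no x∉ys = trans (filter-accept (_∉? map f ys) (λ fx∈ → x∉ys (reflects (here refl) fx∈)))
                      (cong (f x ∷_) (filter-∉-map f xs (reflects ∘ there)))

module _ {a p} {A : Set a} {P : Pred A p} (P? : Decidable P) where

  filter-∷ʳ-accept : ∀ {x} xs → P x → filter P? (xs ∷ʳ x) ≡ filter P? xs ∷ʳ x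
  filter-∷ʳ-accept xs px = trans (filter-++ P? xs _) (cong (filter P? xs ++_) (filter-accept P? px))

  filter-∷ʳ-reject : ∀ {x} xs → ¬ P x → filter P? (xs ∷ʳ x) ≡ filter P? xs
  filter-∷ʳ-reject xs ¬px = begin
    filter P? (xs ∷ʳ _)              ≡⟨ filter-++ P? xs _ ⟩
    filter P? xs ++ filter P? [ _ ]  ≡⟨ cong (filter P? xs ++_) (filter-reject P? ¬px) ⟩
    filter P? xs ++ []               ≡⟨ ++-identityʳ _ ⟩
    filter P? xs                     ∎

Bounded : ℕ → List ℕ → Set
Bounded M = All (λ x → 1 ≤ x × x ≤ M)

positive : ∀ {M xs} → Bounded M xs → All (1 ≤_) xs
positive = All.map proj₁

∸1-injective : ∀ {x y} → 1 ≤ x → 1 ≤ y → x ∸ 1 ≡ y ∸ 1 → x ≡ y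
∸1-injective (s≤s _) (s≤s _) refl = refl

∸1-< : ∀ {x M} → 1 ≤ x → x ≤ M → x ∸ 1 < M
∸1-< (s≤s _) x≤M = x≤M

∉-map-∸1 : ∀ {M xs} → Bounded M xs → M ∉ map (_∸ 1) xs
∉-map-∸1 bounded M∈ with y , y∈xs , M≡y∸1 ← ∈-map⁻ (_∸ 1) M∈ =
  <-irrefl (sym M≡y∸1) (∸1-< (proj₁ (All.lookup bounded y∈xs)) (proj₂ (All.lookup bounded y∈xs)))

filter-∉-map-∸1 : ∀ {xs ys} → All (1 ≤_) xs → All (1 ≤_) ys →
                  filter (_∉? map (_∸ 1) ys) (map (_∸ 1) xs) ≡ map (_∸ 1) (filter (_∉? ys) xs)
filter-∉-map-∸1 {xs} {ys} xs≥1 ys≥1 = filter-∉-map (_∸ 1) xs reflects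
  where
  reflects : ∀ {x} → x ∈ xs → x ∸ 1 ∈ map (_∸ 1) ys → x ∈ ys
  reflects x∈xs x∸1∈ with y , y∈ys , eq ← ∈-map⁻ (_∸ 1) x∸1∈
    rewrite ∸1-injective (All.lookup xs≥1 x∈xs) (All.lookup ys≥1 y∈ys) eq = y∈ys

finalize-slide : ∀ M xs → map (finalCell M) (slide xs) ≡ map (_∸ 1) xs ∷ʳ M
finalize-slide M [] = refl
finalize-slide M (x ∷ xs) = cong (x ∸ 1 ∷_) (finalize-slide M xs)

finalize-keep : ∀ M xs → map (finalCell M) (keep xs) ≡ map (_∸ 1) xs
finalize-keep M xs = sym (map-∘ xs)

kPromotion-armFirst : ∀ M c {x y} xs ys → x < y →
  kPromotion M (hook c (x ∷ xs) (y ∷ ys)) ≡ hook (x ∸ 1) (map (_∸ 1) xs ∷ʳ M) (map (_∸ 1) (y ∷ ys))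
kPromotion-armFirst M c {x} {y} xs ys x<y with x <ᵇ y | <⇒<ᵇ x<y
... | true | _ = cong₂ (hook (x ∸ 1)) (finalize-slide M xs) (finalize-keep M (y ∷ ys))

kPromotion-tie : ∀ M c x xs ys →
  kPromotion M (hook c (x ∷ xs) (x ∷ ys)) ≡ hook (x ∸ 1) (map (_∸ 1) xs ∷ʳ M) (map (_∸ 1) ys ∷ʳ M)
kPromotion-tie M c x xs ys with x <ᵇ x | <ᵇ⇒< x x
... | true  | x<x = ⊥-elim (<-irrefl refl (x<x _))
... | false | _   = cong₂ (hook (x ∸ 1)) (finalize-slide M xs) (finalize-slide M ys)

kPromotion-legFirst : ∀ M c {y} xs ys → All (y <_) xs →
  kPromotion M (hook c xs (y ∷ ys)) ≡ hook (y ∸ 1) (map (_∸ 1) xs) (map (_∸ 1) ys ∷ʳ M)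
kPromotion-legFirst M c [] ys [] = cong (hook _ []) (finalize-slide M ys)
kPromotion-legFirst M c {y} (x ∷ xs) ys (y<x ∷ _) with x <ᵇ y | <ᵇ⇒< x y
... | true  | x<y = ⊥-elim (<-asym y<x (x<y _))
... | false | _ with y <ᵇ x | <⇒<ᵇ y<x
...   | true | _ = cong₂ (hook (y ∸ 1)) (finalize-keep M (x ∷ xs)) (finalize-slide M ys)

ψ-legless : ∀ c xs → ψ (hook c xs []) ≡ hook c xs []
ψ-legless c xs = cong (λ arm → hook c arm []) (filter-∉-[] xs)

ψ-kPromotion-legFirst : ∀ M c {y} xs ys → All (y <_) xs → Bounded M xs → Bounded M ys →
  ψ (kPromotion M (hook c xs (y ∷ ys))) ≡ kPromotion M (ψ (hook c xs (y ∷ ys)))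
ψ-kPromotion-legFirst M c {y} xs ys y<xs bxs bys = begin
  ψ (kPromotion M (hook c xs (y ∷ ys)))
    ≡⟨ cong ψ (kPromotion-legFirst M c xs ys y<xs) ⟩
  hook (y ∸ 1) (filter (_∉? (map (_∸ 1) ys ∷ʳ M)) (map (_∸ 1) xs)) (map (_∸ 1) ys ∷ʳ M)
    ≡⟨ cong (λ arm → hook (y ∸ 1) arm (map (_∸ 1) ys ∷ʳ M)) arm≡ ⟩
  hook (y ∸ 1) (map (_∸ 1) (filter (_∉? ys) xs)) (map (_∸ 1) ys ∷ʳ M)
    ≡⟨ sym (kPromotion-legFirst M c (filter (_∉? ys) xs) ys (filter⁺ (_∉? ys) y<xs)) ⟩
  kPromotion M (hook c (filter (_∉? ys) xs) (y ∷ ys))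
    ≡⟨ cong (λ arm → kPromotion M (hook c arm (y ∷ ys))) (sym (filter-∉-∷ xs (<-all⇒∉ y<xs))) ⟩
  kPromotion M (ψ (hook c xs (y ∷ ys))) ∎
  where
  arm≡ : filter (_∉? (map (_∸ 1) ys ∷ʳ M)) (map (_∸ 1) xs) ≡ map (_∸ 1) (filter (_∉? ys) xs)
  arm≡ = trans (filter-∉-++ʳ (map (_∸ 1) xs) λ { (M∈ , here refl) → ∉-map-∸1 bxs M∈ })
               (filter-∉-map-∸1 (positive bxs) (positive bys))

-- When the dot splits at a tie x = x, ψ deletes both the arm's x and the dot that slid to the end
-- of the arm, which reduces the tie to the leg-first case for the shorter arm.
ψ-kPromotion-tie : ∀ M c x xs ys → All (x <_) xs → Bounded M xs → Bounded M ys →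
  ψ (kPromotion M (hook c (x ∷ xs) (x ∷ ys))) ≡ kPromotion M (ψ (hook c (x ∷ xs) (x ∷ ys)))
ψ-kPromotion-tie M c x xs ys x<xs bxs bys = begin
  ψ (kPromotion M (hook c (x ∷ xs) (x ∷ ys)))
    ≡⟨ cong ψ (kPromotion-tie M c x xs ys) ⟩
  hook (x ∸ 1) (filter (_∉? lowered) (map (_∸ 1) xs ∷ʳ M)) lowered
    ≡⟨ cong (λ arm → hook (x ∸ 1) arm lowered) dot-deleted ⟩
  ψ (hook (x ∸ 1) (map (_∸ 1) xs) lowered)
    ≡⟨ cong ψ (sym (kPromotion-legFirst M c xs ys x<xs)) ⟩
  ψ (kPromotion M (hook c xs (x ∷ ys)))
    ≡⟨ ψ-kPromotion-legFirst M c xs ys x<xs bxs bys ⟩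
  kPromotion M (ψ (hook c xs (x ∷ ys)))
    ≡⟨ cong (λ arm → kPromotion M (hook c arm (x ∷ ys))) (sym x-deleted) ⟩
  kPromotion M (ψ (hook c (x ∷ xs) (x ∷ ys))) ∎
  where
  lowered : List ℕ
  lowered = map (_∸ 1) ys ∷ʳ M
  dot-deleted : filter (_∉? lowered) (map (_∸ 1) xs ∷ʳ M) ≡ filter (_∉? lowered) (map (_∸ 1) xs)
  dot-deleted = filter-∷ʳ-reject (_∉? lowered) (map (_∸ 1) xs) (λ M∉ → M∉ (∈-++⁺ʳ _ (here refl)))
  x-deleted : filter (_∉? (x ∷ ys)) (x ∷ xs) ≡ filter (_∉? (x ∷ ys)) xs
  x-deleted = filter-reject (_∉? (x ∷ ys)) (λ x∉ → x∉ (here refl))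

ψ-kPromotion-armFirst : ∀ M c {x y} xs ys → All (x <_) (y ∷ ys) → Bounded M xs → Bounded M (y ∷ ys) →
  ψ (kPromotion M (hook c (x ∷ xs) (y ∷ ys))) ≡ kPromotion M (ψ (hook c (x ∷ xs) (y ∷ ys)))
ψ-kPromotion-armFirst M c {x} {y} xs ys x<L@(x<y ∷ _) bxs bL = begin
  ψ (kPromotion M (hook c (x ∷ xs) L))
    ≡⟨ cong ψ (kPromotion-armFirst M c xs ys x<y) ⟩
  hook (x ∸ 1) (filter (_∉? map (_∸ 1) L) (map (_∸ 1) xs ∷ʳ M)) (map (_∸ 1) L)
    ≡⟨ cong (λ arm → hook (x ∸ 1) arm (map (_∸ 1) L)) arm≡ ⟩
  hook (x ∸ 1) (map (_∸ 1) (filter (_∉? L) xs) ∷ʳ M) (map (_∸ 1) L)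
    ≡⟨ sym (kPromotion-armFirst M c (filter (_∉? L) xs) ys x<y) ⟩
  kPromotion M (hook c (x ∷ filter (_∉? L) xs) L)
    ≡⟨ cong (λ arm → kPromotion M (hook c arm L)) (sym (filter-accept (_∉? L) (<-all⇒∉ x<L))) ⟩
  kPromotion M (ψ (hook c (x ∷ xs) L)) ∎
  where
  L : List ℕ
  L = y ∷ ys
  arm≡ : filter (_∉? map (_∸ 1) L) (map (_∸ 1) xs ∷ʳ M) ≡ map (_∸ 1) (filter (_∉? L) xs) ∷ʳ M
  arm≡ = trans (filter-∷ʳ-accept (_∉? map (_∸ 1) L) (map (_∸ 1) xs) (∉-map-∸1 bL))
               (cong (_∷ʳ M) (filter-∉-map-∸1 (positive bxs) (positive bL)))

ψ-kPromotion : ∀ M c xs ys → Linked _<_ xs → Linked _<_ ys → Bounded M xs → Bounded M ys →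
  ψ (kPromotion M (hook c xs ys)) ≡ kPromotion M (ψ (hook c xs ys))
ψ-kPromotion M c [] [] _ _ _ _ = refl
ψ-kPromotion M c [] (y ∷ ys) _ _ _ _ = refl
ψ-kPromotion M c (x ∷ xs) [] _ _ _ _ =
  trans (ψ-legless _ _) (cong (kPromotion M) (sym (ψ-legless c (x ∷ xs))))
ψ-kPromotion M c (x ∷ xs) (y ∷ ys) xs↑ ys↑ bxs bys with <-cmp x y
... | tri< x<y _ _ = ψ-kPromotion-armFirst M c xs ys (Linked⇒All <-trans x<y ys↑) (All.tail bxs) bys
... | tri≈ _ refl _ = ψ-kPromotion-tie M c x xs ys (head<tail xs↑) (All.tail bxs) (All.tail bys)
... | tri> _ _ y<x = ψ-kPromotion-legFirst M c (x ∷ xs) ys (Linked⇒All <-trans y<x xs↑) bxs (All.tail bys)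

unique∧set⇒length≡ : ∀ {a} {A : Set a} {xs ys : List A} → Unique xs → Unique ys →
                     (∀ {z} → z ∈ xs ⇔ z ∈ ys) → length xs ≡ length ys
unique∧set⇒length≡ xs! ys! same = ↭-length (∼bag⇒↭ (unique∧set⇒bag xs! ys! same))

∈-cells-ψ⇔ : ∀ T {z} → z ∈ cells (ψ T) ⇔ z ∈ cells T
∈-cells-ψ⇔ (hook c xs ys) = mk⇔ ψ⊆ ⊆ψ
  where
  ψ⊆ : ∀ {z} → z ∈ cells (ψ (hook c xs ys)) → z ∈ cells (hook c xs ys)
  ψ⊆ (here refl) = here refl
  ψ⊆ (there z∈) with ∈-++⁻ (filter (_∉? ys) xs) z∈
  ... | inj₁ z∈xs′ = there (∈-++⁺ˡ (proj₁ (∈-filter⁻ (_∉? ys) {xs = xs} z∈xs′)))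
  ... | inj₂ z∈ys  = there (∈-++⁺ʳ xs z∈ys)
  ⊆ψ : ∀ {z} → z ∈ cells (hook c xs ys) → z ∈ cells (ψ (hook c xs ys))
  ⊆ψ (here refl) = here refl
  ⊆ψ {z} (there z∈) with ∈-++⁻ xs z∈
  ... | inj₂ z∈ys = there (∈-++⁺ʳ _ z∈ys)
  ... | inj₁ z∈xs with z ∈? ys
  ...   | yes z∈ys = there (∈-++⁺ʳ _ z∈ys)
  ...   | no z∉ys  = there (∈-++⁺ˡ (∈-filter⁺ (_∉? ys) z∈xs z∉ys))

unique-cells-ψ : ∀ {c xs ys} → Linked _<_ (c ∷ xs) → Linked _<_ (c ∷ ys) →
                 Unique (cells (ψ (hook c xs ys)))
unique-cells-ψ {c} {xs} {ys} c∷xs↑ c∷ys↑ =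
  All.map <⇒≢ (++⁺ (filter⁺ (_∉? ys) (head<tail c∷xs↑)) (head<tail c∷ys↑)) ∷
  Unique.++⁺ (Unique.filter⁺ (_∉? ys) (Linked-<⇒Unique (Linked.tail c∷xs↑)))
             (Linked-<⇒Unique (Linked.tail c∷ys↑))
             (λ (z∈xs′ , z∈ys) → proj₂ (∈-filter⁻ (_∉? ys) {xs = xs} z∈xs′) z∈ys)

∈-cells⇔range : ∀ {M T} → IsIncreasing M T → ∀ {z} → z ∈ cells T ⇔ z ∈ applyUpTo suc M
∈-cells⇔range {M} {T} (_ , _ , bounded , covered) = mk⇔ in-range in-cells
  where
  in-range : ∀ {z} → z ∈ cells T → z ∈ applyUpTo suc M
  in-range z∈ with All.lookup bounded z∈
  ... | s≤s _ , z≤M = ∈-applyUpTo⁺ suc z≤M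
  in-cells : ∀ {z} → z ∈ applyUpTo suc M → z ∈ cells T
  in-cells z∈ with i , i<M , refl ← ∈-applyUpTo⁻ suc z∈ = covered (suc i) (s≤s z≤n) i<M

size-ψ : ∀ {M} T → IsIncreasing M T → size (ψ T) ≡ M
size-ψ {M} T@(hook c xs ys) increasing@(c∷xs↑ , c∷ys↑ , _) = begin
  size (ψ T)                ≡⟨ cong suc (sym (length-++ (filter (_∉? ys) xs))) ⟩
  length (cells (ψ T))      ≡⟨ unique∧set⇒length≡ (unique-cells-ψ c∷xs↑ c∷ys↑) range!
                                 (⇔.trans (∈-cells-ψ⇔ T) (∈-cells⇔range increasing)) ⟩
  length (applyUpTo suc M)  ≡⟨ length-applyUpTo suc M ⟩
  M                         ∎
  where
  range! : Unique (applyUpTo suc M)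
  range! = Unique.applyUpTo⁺₁ suc M (λ i<j _ → <⇒≢ (s≤s i<j))

lemma3p2 : (N r k : ℕ) → 1 ≤ N → k ≤ r → (T : Hook) → InInc N r k T →
    ψ (kPromotion (N ∸ k) T) ≡ promotion (ψ T)
lemma3p2 N r k _ _ T@(hook c xs ys) (_ , increasing@(c∷xs↑ , c∷ys↑ , bounded , _)) = begin
  ψ (kPromotion (N ∸ k) T)
    ≡⟨ ψ-kPromotion (N ∸ k) c xs ys (Linked.tail c∷xs↑) (Linked.tail c∷ys↑)
                    (++⁻ˡ xs (All.tail bounded)) (++⁻ʳ xs (All.tail bounded)) ⟩
  kPromotion (N ∸ k) (ψ T)
    ≡⟨ cong (λ M → kPromotion M (ψ T)) (sym (size-ψ T increasing)) ⟩
  promotion (ψ T) ∎
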